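{- For every integer $n \ge 5$, the pegging number of the cycle $C_n$ is $P(C_n)=n-2$.
   Context: $C_n$ is the cycle on $n$ vertices. A distribution of pegs on a graph $G$ is a subset $D \subseteq V(G)$. If $u,v \in D$ are distinct adjacent vertices and $w \notin D$ is a vertex adjacent to $v$, the pegging move (jumping $u$ over $v$ into $w$) replaces $D$ by $(D\setminus\{u,v\})\cup\{w\}$. A vertex $t$ is reachable from $D$ if some finite (possibly empty) sequence of pegging moves starting from $D$ ends in a distribution containing $t$; $\mathrm{Reach}(D)$ is the set of reachable vertices. The pegging number $P(G)$ is the smallest positive integer $d$ such that every distribution of size $d$ on $G$ has reach $V(G)$. -}

module Defs where

open import Data.Nat using (ℕ; zero; suc; _≤_; _<_; s≤s; z≤n)
open import Data.Nat.Properties using (≤-trans)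
open import Data.Sum using (inj₁; inj₂)
open import Relation.Binary.PropositionalEquality using (refl; sym; trans)
open import Data.Fin using (Fin; toℕ)
open import Data.Fin.Subset using (Subset; _∈_; _∉_; _-_; _∪_; ⁅_⁆; ∣_∣)
open import Data.Product using (_×_; Σ; ∃; ∃-syntax; _,_)
open import Data.Sum using (_⊎_)
open import Relation.Binary.PropositionalEquality using (_≡_; _≢_)
open import Relation.Binary.Construct.Closure.ReflexiveTransitive using (Star)
open import Relation.Nullary using (¬_)

record Graph (n : ℕ) : Set₁ where
  field
    Adj     : Fin n → Fin n → Set
    symAdj  : ∀ {u v} → Adj u v → Adj v u
    irrefl  : ∀ {u} → ¬ Adj u u

open Graph public

Distribution : ℕ → Set
Distribution n = Subset n

data PegMove {n : ℕ} (G : Graph n) : Distribution n → Distribution n → Set where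
  jump : ∀ {D} (u v w : Fin n) →
         u ∈ D → v ∈ D → u ≢ v → Adj G u v →
         w ∉ D → Adj G v w →
         PegMove G D ((D - u - v) ∪ ⁅ w ⁆)

PegMoves : {n : ℕ} → Graph n → Distribution n → Distribution n → Set
PegMoves G = Star (PegMove G)

Reachable : {n : ℕ} → Graph n → Distribution n → Fin n → Set
Reachable G D t = ∃[ D' ] (PegMoves G D D' × t ∈ D')

FullReach : {n : ℕ} → Graph n → Distribution n → Set
FullReach G D = ∀ t → Reachable G D t

AllReach : {n : ℕ} → Graph n → ℕ → Set
AllReach {n} G d = (D : Distribution n) → ∣ D ∣ ≡ d → FullReach G D

IsPeggingNumber : {n : ℕ} → Graph n → ℕ → Set
IsPeggingNumber G d = 1 ≤ d × AllReach G d × (∀ e → 1 ≤ e → e < d → ¬ AllReach G e)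

-- The cycle C_n on vertices 0,…,n-1: i ~ j iff j ≡ i+1 (mod n) or i ≡ j+1 (mod n).
CycAdj₀ : (n : ℕ) → Fin n → Fin n → Set
CycAdj₀ n i j = (suc (toℕ i) ≡ toℕ j) ⊎ (suc (toℕ i) ≡ n × toℕ j ≡ 0)

CycAdj : (n : ℕ) → Fin n → Fin n → Set
CycAdj n i j = CycAdj₀ n i j ⊎ CycAdj₀ n j i

private
  cyc-sym : ∀ {n} {u v : Fin n} → CycAdj n u v → CycAdj n v u
  cyc-sym (inj₁ p) = inj₂ p
  cyc-sym (inj₂ p) = inj₁ p

  no-succ : ∀ {k : ℕ} → suc k ≢ k
  no-succ ()

  cyc₀-irr : ∀ {n} → 2 ≤ n → {u : Fin n} → ¬ CycAdj₀ n u u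
  cyc₀-irr h (inj₁ p) = no-succ p
  cyc₀-irr h (inj₂ (p , q)) = bad h (trans (sym p) (cong suc q))
    where
      open import Relation.Binary.PropositionalEquality using (cong)
      bad : ∀ {n} → 2 ≤ n → ¬ (n ≡ 1)
      bad (s≤s (s≤s z≤n)) ()

  cyc-irr : ∀ {n} → 2 ≤ n → {u : Fin n} → ¬ CycAdj n u u
  cyc-irr h (inj₁ p) = cyc₀-irr h p
  cyc-irr h (inj₂ p) = cyc₀-irr h p

-- The cycle graph C_n (for n ≥ 2 so that it has no loops).
Cycle : (n : ℕ) → 2 ≤ n → Graph n
Cycle n h = record { Adj = CycAdj n ; symAdj = cyc-sym ; irrefl = cyc-irr h }

5≤⇒2≤ : ∀ {n} → 5 ≤ n → 2 ≤ n
5≤⇒2≤ h = ≤-trans (s≤s (s≤s z≤n)) h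

-- Upper bound: if |D| = n − 2 and t ∉ D, exactly one other vertex is empty. As n ≥ 5 the
-- vertices t, t ± 1, t ± 2 are distinct, so one of the arms t+2, t+1 and t−2, t−1 is full
-- and its pegs jump into t.
-- Lower bound: for 3 + e ≤ n put pegs on 1, …, e. The Fibonacci pagoda weights
-- x ↦ F(x+1) and x ↦ F(e+2−x) do not increase under jumps inside [0, e+1], and both start
-- at F(e+3) − 2; the only jumps leaving [0, e+1] (over e, e+1 into e+2, or over 1, 0 into
-- n−1) use a pair of pegs of weight F(e+3) in one of them. So e+2 is never reached.
module Submission where

open import Defs
import Algebra.Properties.CommutativeSemigroup
open import Data.Bool.Base using (T)
open import Data.Empty using (⊥-elim)
open import Data.Fin using (Fin; zero; suc; toℕ; fromℕ<)
open import Data.Fin.Properties using (toℕ-fromℕ<; toℕ-injective; toℕ<n)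
open import Data.Fin.Subset
open import Data.Fin.Subset.Properties
open import Data.Nat using (ℕ; _<ᵇ_; zero; suc; _+_; _∸_; _≤_; _<_; _≤′_; ≤′-reflexive; ≤′-step; z≤n; s≤s)
open import Data.Nat.Properties
open import Data.Product using (_×_; _,_)
open import Data.Sum using (_⊎_; inj₁; inj₂; [_,_]′)
open import Data.Vec.Base using ([]; _∷_; here; there)
open import Function using (_∘_; id)
open import Relation.Binary.Construct.Closure.ReflexiveTransitive using (ε; _◅_)
open import Relation.Binary.PropositionalEquality
open import Relation.Nullary using (¬_; yes; no)

open Algebra.Properties.CommutativeSemigroup +-commutativeSemigroup using (x∙yz≈y∙xz)

weight : ∀ {n} → (Fin n → ℕ) → Subset n → ℕ
weight g []            = 0
weight g (inside  ∷ p) = g zero + weight (g ∘ suc) p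
weight g (outside ∷ p) = weight (g ∘ suc) p

weight-⊥ : ∀ {n} (g : Fin n → ℕ) → weight g ⊥ ≡ 0
weight-⊥ {zero}  g = refl
weight-⊥ {suc n} g = weight-⊥ (g ∘ suc)

weight-remove : ∀ {n} (g : Fin n → ℕ) {p : Subset n} {x} → x ∈ p → weight g p ≡ g x + weight g (p - x)
weight-remove g {inside ∷ p} here = cong (λ q → g zero + weight (g ∘ suc) q) (sym (p─⊥≡p p))
weight-remove g {inside ∷ p} {suc x} (there x∈p) =
  trans (cong (g zero +_) (weight-remove (g ∘ suc) x∈p)) (x∙yz≈y∙xz (g zero) (g (suc x)) _)
weight-remove g {outside ∷ p} (there x∈p) = weight-remove (g ∘ suc) x∈p

weight-insert : ∀ {n} (g : Fin n → ℕ) {p : Subset n} {x} → x ∉ p → weight g (p ∪ ⁅ x ⁆) ≡ g x + weight g p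
weight-insert g {inside  ∷ p} {zero}  x∉p = ⊥-elim (x∉p here)
weight-insert g {outside ∷ p} {zero}  x∉p = cong (λ q → g zero + weight (g ∘ suc) q) (∪-identityʳ p)
weight-insert g {inside  ∷ p} {suc x} x∉p =
  trans (cong (g zero +_) (weight-insert (g ∘ suc) (x∉p ∘ there))) (x∙yz≈y∙xz (g zero) (g (suc x)) _)
weight-insert g {outside ∷ p} {suc x} x∉p = weight-insert (g ∘ suc) (x∉p ∘ there)

weight-remove₂ : ∀ {n} (g : Fin n → ℕ) {p : Subset n} {x y} → x ∈ p → y ∈ p → x ≢ y →
                 weight g p ≡ g x + g y + weight g (p - x - y)
weight-remove₂ g {p} {x} {y} x∈p y∈p x≢y = begin
  weight g p                           ≡⟨ weight-remove g x∈p ⟩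
  g x + weight g (p - x)               ≡⟨ cong (g x +_) (weight-remove g (x∈p∧x≢y⇒x∈p-y y∈p (≢-sym x≢y))) ⟩
  g x + (g y + weight g (p - x - y))   ≡⟨ +-assoc (g x) (g y) _ ⟨
  g x + g y + weight g (p - x - y)     ∎
  where open ≡-Reasoning

pair≤weight : ∀ {n} (g : Fin n → ℕ) {p : Subset n} {x y} → x ∈ p → y ∈ p → x ≢ y → g x + g y ≤ weight g p
pair≤weight g x∈p y∈p x≢y = ≤-trans (m≤m+n _ _) (≤-reflexive (sym (weight-remove₂ g x∈p y∈p x≢y)))

jump-weight≤ : ∀ {n} (g : Fin n → ℕ) {p : Subset n} {u v w} → u ∈ p → v ∈ p → u ≢ v → w ∉ p →
               g w ≤ g u + g v → weight g ((p - u - v) ∪ ⁅ w ⁆) ≤ weight g p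
jump-weight≤ g {p} {u} {v} {w} u∈p v∈p u≢v w∉p gw≤ = begin
  weight g ((p - u - v) ∪ ⁅ w ⁆)   ≡⟨ weight-insert g (w∉p ∘ p─q⊆p p ⁅ u ⁆ ∘ p─q⊆p (p - u) ⁅ v ⁆) ⟩
  g w + weight g (p - u - v)       ≤⟨ +-monoˡ-≤ _ gw≤ ⟩
  g u + g v + weight g (p - u - v) ≡⟨ weight-remove₂ g u∈p v∈p u≢v ⟨
  weight g p                       ∎
  where open ≤-Reasoning

fib : ℕ → ℕ
fib 0             = 0
fib 1             = 1
fib (suc (suc k)) = fib k + fib (suc k)

fib-≤-suc : ∀ k → fib k ≤ fib (suc k)
fib-≤-suc 0             = z≤n
fib-≤-suc 1             = ≤-refl
fib-≤-suc (suc (suc k)) = m≤n+m (fib (suc (suc k))) (fib (suc k))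

fib-mono′ : ∀ {a b} → a ≤′ b → fib a ≤ fib b
fib-mono′ (≤′-reflexive refl) = ≤-refl
fib-mono′ (≤′-step {b} a≤′b)  = ≤-trans (fib-mono′ a≤′b) (fib-≤-suc b)

fib-mono : ∀ {a b} → a ≤ b → fib a ≤ fib b
fib-mono = fib-mono′ ∘ ≤⇒≤′

-- Adjacency of C_n read on positions: CycAdj₀ n x y is definitionally Step n (toℕ x) (toℕ y).
Step : ℕ → ℕ → ℕ → Set
Step n i j = suc i ≡ j ⊎ (suc i ≡ n × j ≡ 0)

data JumpShape (n : ℕ) : ℕ → ℕ → ℕ → Set where
  rightward  : ∀ a → JumpShape n a (suc a) (suc (suc a))
  leftward   : ∀ c → JumpShape n (suc (suc c)) (suc c) c
  wraparound : ∀ {c} → suc c ≡ n → JumpShape n 1 0 c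

jumpShape : ∀ {n a b c} → suc a ≢ n → suc b ≢ n → a ≢ c →
            Step n a b ⊎ Step n b a → Step n b c ⊎ Step n c b → JumpShape n a b c
jumpShape a≢ b≢ a≢c (inj₁ (inj₂ (a+1≡n , _))) _                          = ⊥-elim (a≢ a+1≡n)
jumpShape a≢ b≢ a≢c (inj₂ (inj₂ (b+1≡n , _))) _                          = ⊥-elim (b≢ b+1≡n)
jumpShape a≢ b≢ a≢c _                          (inj₁ (inj₂ (b+1≡n , _))) = ⊥-elim (b≢ b+1≡n)
jumpShape a≢ b≢ a≢c (inj₁ (inj₁ refl))         (inj₁ (inj₁ refl))         = rightward _
jumpShape a≢ b≢ a≢c (inj₁ (inj₁ refl))         (inj₂ (inj₁ refl))         = ⊥-elim (a≢c refl)
jumpShape a≢ b≢ a≢c (inj₁ (inj₁ refl))         (inj₂ (inj₂ (_ , ())))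
jumpShape a≢ b≢ a≢c (inj₂ (inj₁ refl))         (inj₁ (inj₁ refl))         = ⊥-elim (a≢c refl)
jumpShape a≢ b≢ a≢c (inj₂ (inj₁ refl))         (inj₂ (inj₁ refl))         = leftward _
jumpShape a≢ b≢ a≢c (inj₂ (inj₁ refl))         (inj₂ (inj₂ (c+1≡n , refl))) = wraparound c+1≡n

rightWeight : ℕ → ℕ
rightWeight a = fib (suc a)

leftWeight : ℕ → ℕ → ℕ
leftWeight e a = fib (suc (suc e) ∸ a)

leftWeight-recurrence : ∀ {e c} → c ≤ e → leftWeight e c ≡ leftWeight e (suc (suc c)) + leftWeight e (suc c)
leftWeight-recurrence {e} {c} c≤e = begin
  fib (suc (suc e) ∸ c)              ≡⟨ cong fib (+-∸-assoc 2 c≤e) ⟩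
  fib (e ∸ c) + fib (suc (e ∸ c))    ≡⟨ cong (λ k → fib (e ∸ c) + fib k) (+-∸-assoc 1 c≤e) ⟨
  fib (e ∸ c) + fib (suc e ∸ c)      ∎
  where open ≡-Reasoning

band-jump : ∀ {n e a b c} → JumpShape n a b c → a ≤ suc e → b ≤ suc e →
            rightWeight a + rightWeight b < fib (3 + e) → leftWeight e a + leftWeight e b < fib (3 + e) →
            c ≤ suc e × rightWeight c ≤ rightWeight a + rightWeight b × leftWeight e c ≤ leftWeight e a + leftWeight e b
band-jump {e = e} (rightward a) _ (s≤s a≤e) right< _ with m≤n⇒m<n∨m≡n a≤e
... | inj₂ refl = ⊥-elim (<-irrefl refl right<)
... | inj₁ a<e  = s≤s a<e , ≤-refl , ≤-trans (fib-mono (∸-monoˡ-≤ a (n≤1+n e))) (m≤n+m _ _)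
band-jump (leftward c) (s≤s c<e) _ _ _ =
  m<n⇒m≤1+n c<e ,
  ≤-trans (fib-≤-suc (suc c)) (m≤n+m (rightWeight (suc c)) (rightWeight (suc (suc c)))) ,
  ≤-reflexive (leftWeight-recurrence (<⇒≤ c<e))
band-jump (wraparound _) _ _ _ left< = ⊥-elim (<-irrefl refl left<)

∈-jump : ∀ {n} {p : Subset n} {u v w x} → x ∈ (p - u - v) ∪ ⁅ w ⁆ → x ∈ p ⊎ x ≡ w
∈-jump {p = p} {u} {v} {w} x∈ with x∈p∪q⁻ (p - u - v) ⁅ w ⁆ x∈
... | inj₁ x∈p-u-v = inj₁ (p─q⊆p p ⁅ u ⁆ (p─q⊆p (p - u) ⁅ v ⁆ x∈p-u-v))
... | inj₂ x∈⁅w⁆   = inj₂ (x∈⁅y⁆⇒x≡y w x∈⁅w⁆)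

record Blocked {n : ℕ} (e : ℕ) (D : Subset n) : Set where
  field
    confined     : ∀ {x} → x ∈ D → toℕ x ≤ suc e
    rightWeight< : weight (rightWeight ∘ toℕ) D < fib (3 + e)
    leftWeight<  : weight (leftWeight e ∘ toℕ) D < fib (3 + e)

module _ {n e : ℕ} (2≤n : 2 ≤ n) (3+e≤n : 3 + e ≤ n) where

  blocked-move : ∀ {D D′} → PegMove (Cycle n 2≤n) D D′ → Blocked e D → Blocked e D′
  blocked-move {D} (jump u v w u∈D v∈D u≢v u~v w∉D v~w) blocked =
    let w≤ , right≤ , left≤ = band-jump shape (confined u∈D) (confined v∈D)
                                (≤-<-trans (pair≤weight _ u∈D v∈D u≢v) rightWeight<)
                                (≤-<-trans (pair≤weight _ u∈D v∈D u≢v) leftWeight<)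
    in record
      { confined     = [ confined , (λ { refl → w≤ }) ]′ ∘ ∈-jump
      ; rightWeight< = ≤-<-trans (jump-weight≤ _ u∈D v∈D u≢v w∉D right≤) rightWeight<
      ; leftWeight<  = ≤-<-trans (jump-weight≤ _ u∈D v∈D u≢v w∉D left≤) leftWeight<
      }
    where
    open Blocked blocked

    below-last : ∀ {x} → x ∈ D → suc (toℕ x) ≢ n
    below-last x∈D = <⇒≢ (≤-trans (s≤s (s≤s (confined x∈D))) 3+e≤n)

    u≢w : toℕ u ≢ toℕ w
    u≢w u≡w = w∉D (subst (_∈ D) (toℕ-injective u≡w) u∈D)

    shape : JumpShape n (toℕ u) (toℕ v) (toℕ w)
    shape = jumpShape (below-last u∈D) (below-last v∈D) u≢w u~v v~w

  blocked-moves : ∀ {D D′} → PegMoves (Cycle n 2≤n) D D′ → Blocked e D → Blocked e D′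
  blocked-moves ε        = id
  blocked-moves (m ◅ ms) = blocked-moves ms ∘ blocked-move m

first : ℕ → (N : ℕ) → Subset N
first zero    N       = ⊥
first (suc k) zero    = []
first (suc k) (suc N) = inside ∷ first k N

∣first∣ : ∀ {k N} → k ≤ N → ∣ first k N ∣ ≡ k
∣first∣ {zero}  {N}     _         = ∣⊥∣≡0 N
∣first∣ {suc k} {suc N} (s≤s k≤N) = cong suc (∣first∣ k≤N)

∈first⇒< : ∀ {k N} {x : Fin N} → x ∈ first k N → toℕ x < k
∈first⇒< {zero}                 x∈ = ⊥-elim (∉⊥ x∈)
∈first⇒< {suc k} {suc N} {zero}  here        = s≤s z≤n
∈first⇒< {suc k} {suc N} {suc x} (there x∈) = s≤s (∈first⇒< x∈)

weight-first-recurrent : (f : ℕ → ℕ) → (∀ k → f (suc (suc k)) ≡ f k + f (suc k)) →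
                         ∀ {k N} → k ≤ N → weight (f ∘ toℕ) (first k N) + f 1 ≡ f (suc k)
weight-first-recurrent f rec {zero}  {N}     _         = cong (_+ f 1) (weight-⊥ {N} (f ∘ toℕ))
weight-first-recurrent f rec {suc k} {suc N} (s≤s k≤N) = begin
  f 0 + W + f 1   ≡⟨ +-assoc (f 0) W (f 1) ⟩
  f 0 + (W + f 1) ≡⟨ x∙yz≈y∙xz (f 0) W (f 1) ⟩
  W + (f 0 + f 1) ≡⟨ cong (W +_) (rec 0) ⟨
  W + f 2         ≡⟨ weight-first-recurrent (f ∘ suc) (rec ∘ suc) k≤N ⟩
  f (suc (suc k)) ∎
  where
  open ≡-Reasoning
  W : ℕ
  W = weight (f ∘ suc ∘ toℕ) (first k N)

weight-first-reversed-fib : ∀ {k N} → k ≤ N → weight (λ x → fib (suc k ∸ toℕ x)) (first k N) + 2 ≡ fib (3 + k)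
weight-first-reversed-fib {zero}  {N}     _         = cong (_+ 2) (weight-⊥ {N} _)
weight-first-reversed-fib {suc k} {suc N} (s≤s k≤N) =
  trans (+-assoc (fib (2 + k)) _ 2) (cong (fib (2 + k) +_) (weight-first-reversed-fib k≤N))

block : ℕ → (N : ℕ) → Subset (suc N)
block e N = outside ∷ first e N

block-blocked : ∀ {e N} → e ≤ N → Blocked e (block e N)
block-blocked {e} {N} e≤N = record
  { confined     = λ { (there x∈) → s≤s (<⇒≤ (∈first⇒< x∈)) }
  ; rightWeight< = +2≡⇒< (weight-first-recurrent (fib ∘ (2 +_)) (λ _ → refl) e≤N)
  ; leftWeight<  = +2≡⇒< (weight-first-reversed-fib e≤N)
  }
  where
  +2≡⇒< : ∀ {a b} → a + 2 ≡ b → a < b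
  +2≡⇒< {a} refl = m<m+n a (s≤s z≤n)

cycle-¬AllReach : ∀ {n e} (2≤n : 2 ≤ n) → 3 + e ≤ n → ¬ AllReach (Cycle n 2≤n) e
cycle-¬AllReach {suc N} {e} 2≤n 3+e≤n allReach =
  let _ , moves , target∈D = allReach (block e N) (∣first∣ e≤N) target
      target≤ = Blocked.confined (blocked-moves 2≤n 3+e≤n moves (block-blocked e≤N)) target∈D
  in 1+n≰n (subst (_≤ suc e) (toℕ-fromℕ< 3+e≤n) target≤)
  where
  e≤N : e ≤ N
  e≤N = ≤-trans (m≤n+m e 2) (≤-pred 3+e≤n)

  target : Fin (suc N)
  target = fromℕ< 3+e≤n

three-elements⇒3≤∣p∣ : ∀ {n} {p : Subset n} {x y z} → x ∈ p → y ∈ p → z ∈ p →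
                       x ≢ y → x ≢ z → y ≢ z → 3 ≤ ∣ p ∣
three-elements⇒3≤∣p∣ {p = p} {x} {y} {z} x∈p y∈p z∈p x≢y x≢z y≢z =
  ≤-trans (s≤s (≤-trans (s≤s 1≤∣p-x-y∣) (x∈p⇒∣p-x∣<∣p∣ y∈p-x))) (x∈p⇒∣p-x∣<∣p∣ x∈p)
  where
  y∈p-x : y ∈ p - x
  y∈p-x = x∈p∧x≢y⇒x∈p-y y∈p (≢-sym x≢y)

  z∈p-x-y : z ∈ p - x - y
  z∈p-x-y = x∈p∧x≢y⇒x∈p-y (x∈p∧x≢y⇒x∈p-y z∈p (≢-sym x≢z)) (≢-sym y≢z)

  1≤∣p-x-y∣ : 1 ≤ ∣ p - x - y ∣
  1≤∣p-x-y∣ = ≤-trans (s≤s z≤n) (x∈p⇒∣p-x∣<∣p∣ z∈p-x-y)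

module _ {n : ℕ} (G : Graph n) where

  Adj⇒≢ : ∀ {u v} → Adj G u v → u ≢ v
  Adj⇒≢ u~v refl = irrefl G u~v

  reach-by-jump : ∀ {D u v t} → Adj G u v → Adj G v t → u ∈ D → v ∈ D → t ∉ D → Reachable G D t
  reach-by-jump u~v v~t u∈D v∈D t∉D =
    _ , jump _ _ _ u∈D v∈D (Adj⇒≢ u~v) u~v t∉D v~t ◅ ε , x∈p∪q⁺ (inj₂ (x∈⁅x⁆ _))

  record TwoArms (t : Fin n) : Set where
    field
      r₁ r₂ l₁ l₂ : Fin n
      r₂~r₁ : Adj G r₂ r₁
      r₁~t  : Adj G r₁ t
      l₂~l₁ : Adj G l₂ l₁
      l₁~t  : Adj G l₁ t
      t≢r₂  : t ≢ r₂
      t≢l₂  : t ≢ l₂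
      r₁≢l₁ : r₁ ≢ l₁
      r₁≢l₂ : r₁ ≢ l₂
      r₂≢l₁ : r₂ ≢ l₁
      r₂≢l₂ : r₂ ≢ l₂

  module _ {D : Subset n} {t : Fin n} (arms : TwoArms t) (t∉D : t ∉ D) (∣∁D∣<3 : ∣ ∁ D ∣ < 3) where
    open TwoArms arms

    private
      two-more-holes : ∀ {x y} → x ∉ D → y ∉ D → t ≢ x → t ≢ y → x ≢ y → Reachable G D t
      two-more-holes x∉D y∉D t≢x t≢y x≢y =
        ⊥-elim (<⇒≱ ∣∁D∣<3 (three-elements⇒3≤∣p∣ (x∉p⇒x∈∁p t∉D) (x∉p⇒x∈∁p x∉D) (x∉p⇒x∈∁p y∉D) t≢x t≢y x≢y))

      t≢r₁ : t ≢ r₁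
      t≢r₁ = ≢-sym (Adj⇒≢ r₁~t)

      t≢l₁ : t ≢ l₁
      t≢l₁ = ≢-sym (Adj⇒≢ l₁~t)

    reach-hole : Reachable G D t
    reach-hole with r₂ ∈? D | r₁ ∈? D | l₂ ∈? D | l₁ ∈? D
    ... | yes r₂∈D | yes r₁∈D | _        | _        = reach-by-jump r₂~r₁ r₁~t r₂∈D r₁∈D t∉D
    ... | _        | _        | yes l₂∈D | yes l₁∈D = reach-by-jump l₂~l₁ l₁~t l₂∈D l₁∈D t∉D
    ... | no r₂∉D  | _        | no l₂∉D  | _        = two-more-holes r₂∉D l₂∉D t≢r₂ t≢l₂ r₂≢l₂
    ... | no r₂∉D  | _        | yes _    | no l₁∉D  = two-more-holes r₂∉D l₁∉D t≢r₂ t≢l₁ r₂≢l₁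
    ... | yes _    | no r₁∉D  | no l₂∉D  | _        = two-more-holes r₁∉D l₂∉D t≢r₁ t≢l₂ r₁≢l₂
    ... | yes _    | no r₁∉D  | yes _    | no l₁∉D  = two-more-holes r₁∉D l₁∉D t≢r₁ t≢l₁ r₁≢l₁

record Window (n c : ℕ) : Set where
  constructor window
  field
    r₁ r₂ l₁ l₂ : ℕ
    r₁<n : r₁ < n
    r₂<n : r₂ < n
    l₁<n : l₁ < n
    l₂<n : l₂ < n
    c→r₁  : Step n c r₁
    r₁→r₂ : Step n r₁ r₂
    l₂→l₁ : Step n l₂ l₁
    l₁→c  : Step n l₁ c
    c≢r₂  : c ≢ r₂
    c≢l₂  : c ≢ l₂
    r₁≢l₁ : r₁ ≢ l₁
    r₁≢l₂ : r₁ ≢ l₂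
    r₂≢l₁ : r₂ ≢ l₁
    r₂≢l₂ : r₂ ≢ l₂

Window⇒TwoArms : ∀ {n c} (2≤n : 2 ≤ n) {t : Fin n} → toℕ t ≡ c → Window n c → TwoArms (Cycle n 2≤n) t
Window⇒TwoArms 2≤n t≡c (window r₁ r₂ l₁ l₂ r₁<n r₂<n l₁<n l₂<n c→r₁ r₁→r₂ l₂→l₁ l₁→c
                                c≢r₂ c≢l₂ r₁≢l₁ r₁≢l₂ r₂≢l₁ r₂≢l₂) = record
  { r₁ = fromℕ< r₁<n ; r₂ = fromℕ< r₂<n ; l₁ = fromℕ< l₁<n ; l₂ = fromℕ< l₂<n
  ; r₂~r₁ = inj₂ (Step⇒CycAdj₀ r₁≡ r₂≡ r₁→r₂)
  ; r₁~t  = inj₂ (Step⇒CycAdj₀ t≡c r₁≡ c→r₁)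
  ; l₂~l₁ = inj₁ (Step⇒CycAdj₀ l₂≡ l₁≡ l₂→l₁)
  ; l₁~t  = inj₁ (Step⇒CycAdj₀ l₁≡ t≡c l₁→c)
  ; t≢r₂  = toℕ≢⇒≢ t≡c r₂≡ c≢r₂
  ; t≢l₂  = toℕ≢⇒≢ t≡c l₂≡ c≢l₂
  ; r₁≢l₁ = toℕ≢⇒≢ r₁≡ l₁≡ r₁≢l₁
  ; r₁≢l₂ = toℕ≢⇒≢ r₁≡ l₂≡ r₁≢l₂
  ; r₂≢l₁ = toℕ≢⇒≢ r₂≡ l₁≡ r₂≢l₁
  ; r₂≢l₂ = toℕ≢⇒≢ r₂≡ l₂≡ r₂≢l₂
  }
  where
  r₁≡ : toℕ (fromℕ< r₁<n) ≡ r₁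
  r₁≡ = toℕ-fromℕ< r₁<n
  r₂≡ : toℕ (fromℕ< r₂<n) ≡ r₂
  r₂≡ = toℕ-fromℕ< r₂<n
  l₁≡ : toℕ (fromℕ< l₁<n) ≡ l₁
  l₁≡ = toℕ-fromℕ< l₁<n
  l₂≡ : toℕ (fromℕ< l₂<n) ≡ l₂
  l₂≡ = toℕ-fromℕ< l₂<n

  Step⇒CycAdj₀ : ∀ {n} {x y : Fin n} {i j} → toℕ x ≡ i → toℕ y ≡ j → Step n i j → CycAdj₀ n x y
  Step⇒CycAdj₀ refl refl step = step

  toℕ≢⇒≢ : ∀ {n} {x y : Fin n} {i j} → toℕ x ≡ i → toℕ y ≡ j → i ≢ j → x ≢ y
  toℕ≢⇒≢ refl refl i≢j refl = i≢j refl

data Position (m : ℕ) : ℕ → Set where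
  at-0   : Position m 0
  at-1   : Position m 1
  inner  : ∀ {j} → j ≤ m → Position m (2 + j)
  at-3+m : Position m (3 + m)
  at-4+m : Position m (4 + m)

position : ∀ {m c} → c < 5 + m → Position m c
position {c = 0} _ = at-0
position {c = 1} _ = at-1
position {c = suc (suc j)} (s≤s (s≤s (s≤s j≤2+m))) with m≤n⇒m<n∨m≡n j≤2+m
... | inj₂ refl = at-4+m
... | inj₁ (s≤s j≤1+m) with m≤n⇒m<n∨m≡n j≤1+m
...   | inj₂ refl      = at-3+m
...   | inj₁ (s≤s j≤m) = inner j≤m

module _ {m : ℕ} where
  private
    literal<5+m : ∀ k → T (k <ᵇ 5) → k < 5 + m
    literal<5+m k k<5 = ≤-trans (<ᵇ⇒< k 5 k<5) (m≤m+n 5 m)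

    +m<5+m : ∀ k → T (k <ᵇ 5) → k + m < 5 + m
    +m<5+m k k<5 = +-monoˡ-< m (<ᵇ⇒< k 5 k<5)

    +j<5+m : ∀ {j} k → T (k <ᵇ 5) → j ≤ m → k + j < 5 + m
    +j<5+m k k<5 = +-mono-<-≤ (<ᵇ⇒< k 5 k<5)

  cycle-window : ∀ {c} → Position m c → Window (5 + m) c
  cycle-window at-0 =
    window 1 2 (4 + m) (3 + m) (literal<5+m 1 _) (literal<5+m 2 _) (+m<5+m 4 _) (+m<5+m 3 _)
      (inj₁ refl) (inj₁ refl) (inj₁ refl) (inj₂ (refl , refl))
      (λ ()) (λ ()) (λ ()) (λ ()) (λ ()) (λ ())
  cycle-window at-1 =
    window 2 3 0 (4 + m) (literal<5+m 2 _) (literal<5+m 3 _) (literal<5+m 0 _) (+m<5+m 4 _)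
      (inj₁ refl) (inj₁ refl) (inj₂ (refl , refl)) (inj₁ refl)
      (λ ()) (λ ()) (λ ()) (λ ()) (λ ()) (λ ())
  cycle-window (inner {j} j≤m) =
    window (3 + j) (4 + j) (1 + j) j (+j<5+m 3 _ j≤m) (+j<5+m 4 _ j≤m) (+j<5+m 1 _ j≤m) (+j<5+m 0 _ j≤m)
      (inj₁ refl) (inj₁ refl) (inj₁ refl) (inj₁ refl)
      (λ ()) (λ ()) (λ ()) (λ ()) (λ ()) (λ ())
  cycle-window at-3+m =
    window (4 + m) 0 (2 + m) (1 + m) (+m<5+m 4 _) (literal<5+m 0 _) (+m<5+m 2 _) (+m<5+m 1 _)
      (inj₁ refl) (inj₂ (refl , refl)) (inj₁ refl) (inj₁ refl)
      (λ ()) (λ ()) (λ ()) (λ ()) (λ ()) (λ ())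
  cycle-window at-4+m =
    window 0 1 (3 + m) (2 + m) (literal<5+m 0 _) (literal<5+m 1 _) (+m<5+m 3 _) (+m<5+m 2 _)
      (inj₂ (refl , refl)) (inj₁ refl) (inj₁ refl) (inj₁ refl)
      (λ ()) (λ ()) (λ ()) (λ ()) (λ ()) (λ ())

cycle-AllReach : ∀ m (2≤n : 2 ≤ 5 + m) → AllReach (Cycle (5 + m) 2≤n) (3 + m)
cycle-AllReach m 2≤n D ∣D∣≡3+m t with t ∈? D
... | yes t∈D = D , ε , t∈D
... | no  t∉D = reach-hole (Cycle (5 + m) 2≤n) arms t∉D ∣∁D∣<3
  where
  arms : TwoArms (Cycle (5 + m) 2≤n) t
  arms = Window⇒TwoArms 2≤n refl (cycle-window (position (toℕ<n t)))

  ∣∁D∣<3 : ∣ ∁ D ∣ < 3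
  ∣∁D∣<3 = s≤s (≤-reflexive (trans (∣∁p∣≡n∸∣p∣ D) (trans (cong (5 + m ∸_) ∣D∣≡3+m) (m+n∸n≡m 2 m))))

theorem3p1 : (n : ℕ) → (h : 5 ≤ n) → IsPeggingNumber (Cycle n (5≤⇒2≤ h)) (n ∸ 2)
theorem3p1 (suc (suc (suc (suc (suc m))))) 5≤n@(s≤s (s≤s (s≤s (s≤s (s≤s z≤n))))) =
  s≤s z≤n , cycle-AllReach m 2≤n , λ e _ e<3+m → cycle-¬AllReach 2≤n (s≤s (s≤s e<3+m))
  where
  2≤n : 2 ≤ 5 + m
  2≤n = 5≤⇒2≤ 5≤n
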